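{- For integers $q,r\ge2$ and every integer $k$ with $1\le k\le 2q+2r-4$, the grid graph satisfies $\operatorname{wdim}_k(P_q\Box P_r)=k$ if $k$ is even and $\operatorname{wdim}_k(P_q\Box P_r)=k+1$ if $k$ is odd.
   Context: All graphs are finite, simple and connected; $d(u,v)$ is the distance. $P_q\Box P_r$ is the Cartesian product of paths on $q$ and $r$ vertices. For vertices $x,y,s$ put $\Delta_s(x,y)=|d(x,s)-d(y,s)|$, $\Delta_S(x,y)=\sum_{s\in S}\Delta_s(x,y)$. For $k\ge1$, $S\subseteq V(G)$ is a weak $k$-resolving set if $\Delta_S(x,y)\ge k$ for all distinct $x,y\in V(G)$; $\operatorname{wdim}_k(G)$ is the minimum cardinality of a weak $k$-resolving set. -}

module Defs where

open import Data.Nat using (ℕ; zero; suc; _+_; _≤_; ∣_-_∣; _≡ᵇ_)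
open import Data.Bool using (Bool; true; false; _∧_; _∨_; if_then_else_)
open import Data.Fin using (Fin; toℕ)
open import Data.Product using (_×_; _,_; Σ)
open import Data.List using (List; []; _∷_; length; map; cartesianProduct; allFin)
open import Data.Bool.ListAction using (any)
open import Data.Nat.ListAction using (sum)
open import Relation.Binary.PropositionalEquality using (_≡_; _≢_)
open import Relation.Nullary using (does)
open import Relation.Binary.Definitions using (DecidableEquality)
open import Data.List.Relation.Unary.Unique.Propositional using (Unique)
open import Data.List.Membership.Propositional using (_∈_)
import Data.Fin.Properties as FinP
import Data.Product.Properties as ProdP

record FinGraph : Set₁ where
  field
    V     : Set
    verts : List V
    _≟V_  : DecidableEquality V
    adj   : V → V → Bool

module _ (G : FinGraph) where
  open FinGraph G

  reach : ℕ → V → V → Bool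
  reach zero    u v = does (u ≟V v)
  reach (suc n) u v = reach n u v ∨ any (λ w → reach n u w ∧ adj w v) verts

  -- least n ≤ bound with reach n u v, searching from `from`
  -- (returns from + bound if none is found; never happens in connected graphs)
  search : ℕ → ℕ → V → V → ℕ
  search from zero      u v = from
  search from (suc b)   u v = if reach from u v then from else search (suc from) b u v

  -- graph distance d(u,v): the length of a shortest u–v walk
  -- (a shortest walk has length < |V| in a connected graph)
  dist : V → V → ℕ
  dist u v = search 0 (length verts) u v

  ΔS : List V → V → V → ℕ
  ΔS S x y = sum (map (λ s → ∣ dist x s - dist y s ∣) S)

  IsWeakResolving : ℕ → List V → Set
  IsWeakResolving k S = Unique S × (∀ x y → x ≢ y → k ≤ ΔS S x y)

  IsWdim : ℕ → ℕ → Set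
  IsWdim k m =
    Σ (List V) (λ S → IsWeakResolving k S × length S ≡ m)
    × (∀ S → IsWeakResolving k S → m ≤ length S)

Grid : ℕ → ℕ → FinGraph
Grid q r = record
  { V     = Fin q × Fin r
  ; verts = cartesianProduct (allFin q) (allFin r)
  ; _≟V_  = ProdP.≡-dec FinP._≟_ FinP._≟_
  ; adj   = λ { (i , j) (i' , j') →
              ((toℕ i ≡ᵇ toℕ i') ∧ (∣ toℕ j - toℕ j' ∣ ≡ᵇ 1))
              ∨ ((toℕ j ≡ᵇ toℕ j') ∧ (∣ toℕ i - toℕ i' ∣ ≡ᵇ 1)) }
  }

-- In P_q □ P_r the graph distance is the ℓ¹ distance of coordinates.
-- Lower bounds: the adjacent vertices (0,0) and (1,0) are separated by exactly 1 at every vertex,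
-- so k ≤ |S|. At every vertex the two diagonals {(0,0),(1,1)} and {(0,1),(1,0)} of the corner
-- square are separated by 0 and 2 in some order; so if |S| = k, the first diagonal is separated by
-- exactly k, an even number.
-- Upper bound: the two ends of h ≤ q + r − 2 columns or interior rows give 2h landmarks. Relative
-- to such a pair a vertex has distances z + e and (L − z) + e, with z its coordinate along the pair
-- and e its distance to the pair's line, so the pair separates x and y by at least 2|z − z′| and
-- 2|e − e′|. It separates them by less than 2 only if x and y share the coordinate along it and are
-- mirror images in its line. At most one pair does so, and then the coordinate gap of x and y is
-- even, so column 0, which separates them by twice that gap, makes up for it.

module Submission where

open import Defs
open import Data.Nat
open import Data.Nat.Properties
open import Data.Nat.ListAction using (sum)
open import Data.Nat.ListAction.Properties using (sum-++)
open import Data.Nat.Tactic.RingSolver using (solve-∀)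
open import Data.Nat.Divisibility using (_∣_; divides; ∣m∣n⇒∣m+n; m%n≡0⇒n∣m; n∣m⇒m%n≡0)
open import Data.Nat.DivMod using (m≡m%n+[m/n]*n)
open import Algebra.Properties.CommutativeSemigroup +-commutativeSemigroup using (interchange; x∙yz≈y∙xz)
open import Data.Bool using (true; false; T)
open import Data.Bool.Properties using (T-∧; T-∨)
open import Data.Unit using (tt)
open import Data.Empty using (⊥-elim)
open import Data.Fin using (Fin; toℕ; fromℕ; inject₁) renaming (zero to fzero; suc to fsuc)
import Data.Fin.Properties as Fin
open import Data.Product using (_×_; _,_; proj₁; proj₂; uncurry; ∃-syntax; Σ-syntax)
open import Data.Sum using (_⊎_; inj₁; inj₂)
import Data.Sum as Sum
import Data.Product as Product
open import Data.List using (List; []; _∷_; length; map; _++_; take; cartesianProduct; allFin)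
open import Data.List.Properties using (map-++; length-++; length-map; length-tabulate; length-take)
open import Data.List.Relation.Unary.All as All using (All; []; _∷_)
open import Data.List.Relation.Unary.AllPairs as AllPairs using (_∷_)
import Data.List.Relation.Unary.Any as Any
open import Data.List.Relation.Unary.Any.Properties using (any⁺; any⁻)
open import Data.List.Relation.Unary.Unique.Propositional using (Unique)
open import Data.List.Relation.Unary.Unique.Propositional.Properties using (++⁺; map⁺; take⁺; allFin⁺)
open import Data.List.Relation.Binary.Disjoint.Propositional using (Disjoint)
open import Data.Sum.Properties using (inj₁-injective; inj₂-injective)
open import Data.List.Membership.Propositional using (_∈_; lose)
open import Data.List.Membership.Propositional.Properties using (∈-cartesianProduct⁺; ∈-allFin; ∈-map⁻)
open import Function using (_∘_; id)
open import Function.Bundles using (_⇔_; mk⇔; Equivalence)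
open import Relation.Binary.PropositionalEquality
open import Relation.Nullary using (yes; no)

∣m-n+m∣≡n : ∀ m n → ∣ m - n + m ∣ ≡ n
∣m-n+m∣≡n m n = trans (cong (∣ m -_∣) (+-comm n m)) (∣m-m+n∣≡n m n)

m≤n⇒m+∣m-n∣≡n : ∀ {m n} → m ≤ n → m + ∣ m - n ∣ ≡ n
m≤n⇒m+∣m-n∣≡n m≤n = trans (cong (_ +_) (m≤n⇒∣m-n∣≡n∸m m≤n)) (m+[n∸m]≡n m≤n)

∣m-n∣≡1⇒n≡1+m⊎m≡1+n : ∀ {m n} → ∣ m - n ∣ ≡ 1 → n ≡ suc m ⊎ m ≡ suc n
∣m-n∣≡1⇒n≡1+m⊎m≡1+n {zero}  {suc n} e = inj₁ e
∣m-n∣≡1⇒n≡1+m⊎m≡1+n {suc m} {zero}  e = inj₂ e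
∣m-n∣≡1⇒n≡1+m⊎m≡1+n {suc m} {suc n} e = Sum.map (cong suc) (cong suc) (∣m-n∣≡1⇒n≡1+m⊎m≡1+n e)

∣m-n∣≢∣1+m-n∣ : ∀ m n → ∣ m - n ∣ ≢ ∣ suc m - n ∣
∣m-n∣≢∣1+m-n∣ zero    zero    ()
∣m-n∣≢∣1+m-n∣ zero    (suc n) e = 1+n≢n e
∣m-n∣≢∣1+m-n∣ (suc m) zero    e = 1+n≢n (sym e)
∣m-n∣≢∣1+m-n∣ (suc m) (suc n) e = ∣m-n∣≢∣1+m-n∣ m n e

equidistant⇒2≤∣m-n∣ : ∀ {m n b} → m ≢ n → ∣ m - b ∣ ≡ ∣ n - b ∣ → 2 ≤ ∣ m - n ∣
equidistant⇒2≤∣m-n∣ {m} {n} {b} m≢n e with ∣ m - n ∣ in eq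
... | zero        = ⊥-elim (m≢n (∣m-n∣≡0⇒m≡n eq))
... | suc (suc _) = s≤s (s≤s z≤n)
... | suc zero with ∣m-n∣≡1⇒n≡1+m⊎m≡1+n {m} {n} eq
...   | inj₁ refl = ⊥-elim (∣m-n∣≢∣1+m-n∣ m b e)
...   | inj₂ refl = ⊥-elim (∣m-n∣≢∣1+m-n∣ n b (sym e))

equidistant⇒midpoint : ∀ m n b → m ≢ n → ∣ m - b ∣ ≡ ∣ n - b ∣ → m + n ≡ b + b
equidistant⇒midpoint m n zero m≢n e =
  ⊥-elim (m≢n (trans (sym (∣-∣-identityʳ m)) (trans e (∣-∣-identityʳ n))))
equidistant⇒midpoint zero n (suc b) m≢n e = far-end n (m≢n ∘ sym) e
  where
  far-end : ∀ n → n ≢ 0 → suc b ≡ ∣ n - suc b ∣ → n ≡ suc b + suc b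
  far-end n n≢0 e with ∣m-n∣≡[m∸n]∨[n∸m] n (suc b)
  ... | inj₁ e′ = trans (sym (m∸n+n≡m (∣m-n∣≡m∸n⇒n≤m e′))) (cong (_+ suc b) (sym (trans e e′)))
  far-end zero    n≢0 e | inj₂ e′ = ⊥-elim (n≢0 refl)
  far-end (suc n) n≢0 e | inj₂ e′ = ⊥-elim (1+n≰n (≤-trans (≤-reflexive (trans e e′)) (m∸n≤m b n)))
equidistant⇒midpoint (suc m) zero (suc b) m≢n e =
  trans (+-comm (suc m) 0) (equidistant⇒midpoint zero (suc m) (suc b) (m≢n ∘ sym) (sym e))
equidistant⇒midpoint (suc m) (suc n) (suc b) m≢n e = begin
  suc m + suc n     ≡⟨ cong suc (+-suc m n) ⟩
  suc (suc (m + n)) ≡⟨ cong (suc ∘ suc) (equidistant⇒midpoint m n b (m≢n ∘ cong suc) e) ⟩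
  suc (suc (b + b)) ≡⟨ cong suc (+-suc b b) ⟨
  suc b + suc b     ∎
  where open ≡-Reasoning

equidistant-unique : ∀ {m n b c} → m ≢ n → ∣ m - b ∣ ≡ ∣ n - b ∣ → ∣ m - c ∣ ≡ ∣ n - c ∣ → b ≡ c
equidistant-unique {m} {n} {b} {c} m≢n eb ec = begin
  b               ≡⟨ n≡⌊n+n/2⌋ b ⟩
  ⌊ b + b /2⌋     ≡⟨ cong ⌊_/2⌋ (trans (sym (equidistant⇒midpoint m n b m≢n eb)) (equidistant⇒midpoint m n c m≢n ec)) ⟩
  ⌊ c + c /2⌋     ≡⟨ n≡⌊n+n/2⌋ c ⟨
  c               ∎
  where open ≡-Reasoning

∣m+n-o+p∣≤∣m-o∣+∣n-p∣ : ∀ m n o p → ∣ m + n - o + p ∣ ≤ ∣ m - o ∣ + ∣ n - p ∣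
∣m+n-o+p∣≤∣m-o∣+∣n-p∣ m n o p = begin
  ∣ m + n - o + p ∣                     ≤⟨ ∣-∣-triangle (m + n) (o + n) (o + p) ⟩
  ∣ m + n - o + n ∣ + ∣ o + n - o + p ∣ ≡⟨ cong₂ _+_ right-cancel (∣m+n-m+o∣≡∣n-o∣ o n p) ⟩
  ∣ m - o ∣ + ∣ n - p ∣                 ∎
  where
  open ≤-Reasoning
  right-cancel : ∣ m + n - o + n ∣ ≡ ∣ m - o ∣
  right-cancel = trans (cong₂ ∣_-_∣ (+-comm m n) (+-comm o n)) (∣m+n-m+o∣≡∣n-o∣ n m o)

m+p≡n+o⇒∣m-n∣≡∣o-p∣ : ∀ m n o p → m + p ≡ n + o → ∣ m - n ∣ ≡ ∣ o - p ∣
m+p≡n+o⇒∣m-n∣≡∣o-p∣ m n o p eq = begin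
  ∣ m - n ∣         ≡⟨ ∣m+n-m+o∣≡∣n-o∣ p m n ⟨
  ∣ p + m - p + n ∣ ≡⟨ cong₂ ∣_-_∣ (trans (+-comm p m) eq) (+-comm p n) ⟩
  ∣ n + o - n + p ∣ ≡⟨ ∣m+n-m+o∣≡∣n-o∣ n o p ⟩
  ∣ o - p ∣         ∎
  where open ≡-Reasoning

-- z, w: distances of a point along a segment to its two ends; e: its distance to the segment's line.
ends-bound : ∀ z w e z′ w′ e′ → z + w ≡ z′ + w′ →
  let Δ = ∣ z + e - z′ + e′ ∣ + ∣ w + e - w′ + e′ ∣ in
  2 * ∣ z - z′ ∣ ≤ Δ × 2 * ∣ e - e′ ∣ ≤ Δ
ends-bound z w e z′ w′ e′ length≡ = along , across
  where
  open ≤-Reasoning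
  along : 2 * ∣ z - z′ ∣ ≤ ∣ z + e - z′ + e′ ∣ + ∣ w + e - w′ + e′ ∣
  along = begin
    2 * ∣ z - z′ ∣
      ≡⟨ *-distribˡ-∣-∣ 2 z z′ ⟩
    ∣ 2 * z - 2 * z′ ∣
      ≡⟨ m+p≡n+o⇒∣m-n∣≡∣o-p∣ ((z + e) + (w′ + e′)) ((z′ + e′) + (w + e)) (2 * z) (2 * z′) shift ⟨
    ∣ (z + e) + (w′ + e′) - (z′ + e′) + (w + e) ∣
      ≤⟨ ∣m+n-o+p∣≤∣m-o∣+∣n-p∣ (z + e) (w′ + e′) (z′ + e′) (w + e) ⟩
    ∣ z + e - z′ + e′ ∣ + ∣ w′ + e′ - w + e ∣
      ≡⟨ cong (_ +_) (∣-∣-comm (w′ + e′) (w + e)) ⟩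
    ∣ z + e - z′ + e′ ∣ + ∣ w + e - w′ + e′ ∣ ∎
    where
    regroup : ∀ a b c x y → (a + x) + (b + y) + 2 * c ≡ (a + c + x + y) + (c + b)
    regroup = solve-∀
    regroup′ : ∀ a b c x y → (c + y) + (b + x) + 2 * a ≡ (a + c + x + y) + (a + b)
    regroup′ = solve-∀
    shift : (z + e) + (w′ + e′) + 2 * z′ ≡ (z′ + e′) + (w + e) + 2 * z
    shift = begin-equality
      (z + e) + (w′ + e′) + 2 * z′   ≡⟨ regroup z w′ z′ e e′ ⟩
      (z + z′ + e + e′) + (z′ + w′)  ≡⟨ cong (z + z′ + e + e′ +_) length≡ ⟨
      (z + z′ + e + e′) + (z + w)    ≡⟨ regroup′ z w z′ e e′ ⟨
      (z′ + e′) + (w + e) + 2 * z    ∎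
  across : 2 * ∣ e - e′ ∣ ≤ ∣ z + e - z′ + e′ ∣ + ∣ w + e - w′ + e′ ∣
  across = begin
    2 * ∣ e - e′ ∣
      ≡⟨ *-distribˡ-∣-∣ 2 e e′ ⟩
    ∣ 2 * e - 2 * e′ ∣
      ≡⟨ m+p≡n+o⇒∣m-n∣≡∣o-p∣ ((z + e) + (w + e)) ((z′ + e′) + (w′ + e′)) (2 * e) (2 * e′) shift ⟨
    ∣ (z + e) + (w + e) - (z′ + e′) + (w′ + e′) ∣
      ≤⟨ ∣m+n-o+p∣≤∣m-o∣+∣n-p∣ (z + e) (w + e) (z′ + e′) (w′ + e′) ⟩
    ∣ z + e - z′ + e′ ∣ + ∣ w + e - w′ + e′ ∣ ∎
    where
    regroup : ∀ a b x y → (a + x) + (b + x) + 2 * y ≡ (a + b) + (2 * x + 2 * y)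
    regroup = solve-∀
    shift : (z + e) + (w + e) + 2 * e′ ≡ (z′ + e′) + (w′ + e′) + 2 * e
    shift = begin-equality
      (z + e) + (w + e) + 2 * e′     ≡⟨ regroup z w e e′ ⟩
      (z + w) + (2 * e + 2 * e′)     ≡⟨ cong (_+ (2 * e + 2 * e′)) length≡ ⟩
      (z′ + w′) + (2 * e + 2 * e′)   ≡⟨ cong ((z′ + w′) +_) (+-comm (2 * e) (2 * e′)) ⟩
      (z′ + w′) + (2 * e′ + 2 * e)   ≡⟨ regroup z′ w′ e′ e ⟨
      (z′ + e′) + (w′ + e′) + 2 * e  ∎

module _ {A : Set} (f : A → ℕ) where

  2*length≤sum : ∀ {xs} → All (λ x → 2 ≤ f x) xs → 2 * length xs ≤ sum (map f xs)
  2*length≤sum []                  = z≤n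
  2*length≤sum {x ∷ xs} (2≤fx ∷ ps) = begin
    2 * suc (length xs)       ≡⟨ *-suc 2 (length xs) ⟩
    2 + 2 * length xs         ≤⟨ +-mono-≤ 2≤fx (2*length≤sum ps) ⟩
    f x + sum (map f xs)      ∎
    where open ≤-Reasoning

  2*length≤sum-one-light : ∀ {x₀} xs → 2 ≤ f x₀ → (∀ {x} → f x < 2 → 4 ≤ f x₀) →
                           (∀ {x y} → f x < 2 → f y < 2 → x ≡ y) → Unique xs →
                           2 * suc (length xs) ≤ f x₀ + sum (map f xs)
  2*length≤sum-one-light {x₀} [] 2≤fx₀ _ _ _ = ≤-trans 2≤fx₀ (≤-reflexive (sym (+-identityʳ (f x₀))))
  2*length≤sum-one-light {x₀} (x ∷ xs) 2≤fx₀ compensate unique-light (x∉xs ∷ uniq) with f x <? 2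
  ... | no ¬light = begin
    2 * suc (suc (length xs))         ≡⟨ *-suc 2 (suc (length xs)) ⟩
    2 + 2 * suc (length xs)           ≤⟨ +-mono-≤ (≮⇒≥ ¬light) (2*length≤sum-one-light xs 2≤fx₀ compensate unique-light uniq) ⟩
    f x + (f x₀ + sum (map f xs))     ≡⟨ x∙yz≈y∙xz (f x) (f x₀) _ ⟩
    f x₀ + (f x + sum (map f xs))     ∎
    where open ≤-Reasoning
  ... | yes light = begin
    2 * suc (suc (length xs))         ≡⟨ trans (*-suc 2 (suc (length xs))) (cong (2 +_) (*-suc 2 (length xs))) ⟩
    4 + 2 * length xs                 ≤⟨ +-mono-≤ (compensate light) (≤-trans (2*length≤sum rest-heavy) (m≤n+m _ (f x))) ⟩
    f x₀ + (f x + sum (map f xs))     ∎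
    where
    open ≤-Reasoning
    rest-heavy : All (λ y → 2 ≤ f y) xs
    rest-heavy = All.map (λ x≢y → ≮⇒≥ (x≢y ∘ unique-light light)) x∉xs

sum-map-pairs : ∀ {A B : Set} (g : B → ℕ) (u v : A → B) xs →
                sum (map g (map u xs ++ map v xs)) ≡ sum (map (λ x → g (u x) + g (v x)) xs)
sum-map-pairs g u v xs = trans (cong sum (map-++ g (map u xs) (map v xs)))
                               (trans (sum-++ (map g (map u xs)) (map g (map v xs))) (merge xs))
  where
  merge : ∀ xs → sum (map g (map u xs)) + sum (map g (map v xs)) ≡ sum (map (λ x → g (u x) + g (v x)) xs)
  merge []       = refl
  merge (x ∷ xs) = trans (interchange (g (u x)) _ (g (v x)) _) (cong (g (u x) + g (v x) +_) (merge xs))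

sum-map-≡1 : ∀ {A : Set} {g : A → ℕ} → (∀ x → g x ≡ 1) → ∀ xs → sum (map g xs) ≡ length xs
sum-map-≡1 g≡1 []       = refl
sum-map-≡1 g≡1 (x ∷ xs) = cong₂ _+_ (g≡1 x) (sum-map-≡1 g≡1 xs)

module _ (G : FinGraph) where
  open FinGraph G

  search≡threshold : ∀ {u v} M → (∀ n → T (reach G n u v) ⇔ M ≤ n) →
                   ∀ b from → from ≤ M → M ≤ from + b → search G from b u v ≡ M
  search≡threshold M _ zero from from≤M M≤from+0 = ≤-antisym from≤M (≤-trans M≤from+0 (≤-reflexive (+-identityʳ from)))
  search≡threshold {u} {v} M reach⇔ (suc b) from from≤M M≤ with reach G from u v | reach⇔ from
  ... | true  | reached   = ≤-antisym from≤M (Equivalence.to reached tt)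
  ... | false | unreached = search≡threshold M reach⇔ b (suc from) from<M (≤-trans M≤ (≤-reflexive (+-suc from b)))
    where
    from<M : from < M
    from<M = ≤∧≢⇒< from≤M (λ { refl → Equivalence.from unreached ≤-refl })

  module _ (δ : V → V → ℕ)
           (δ≡0⇔≡ : ∀ u v → δ u v ≡ 0 ⇔ u ≡ v)
           (δ-adj : ∀ u w v → T (adj w v) → δ u v ≤ suc (δ u w))
           (δ-step : ∀ u v {n} → δ u v ≡ suc n → ∃[ w ] δ u w ≡ n × T (adj w v))
           (complete : ∀ w → w ∈ verts)
           where

    reach⇔δ≤ : ∀ n {u v} → T (reach G n u v) ⇔ δ u v ≤ n
    reach⇔δ≤ zero {u} {v} with u ≟V v
    ... | yes u≡v = mk⇔ (λ _ → ≤-reflexive (Equivalence.from (δ≡0⇔≡ u v) u≡v)) (λ _ → tt)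
    ... | no  u≢v = mk⇔ (λ ()) (λ δ≤0 → u≢v (Equivalence.to (δ≡0⇔≡ u v) (n≤0⇒n≡0 δ≤0)))
    reach⇔δ≤ (suc n) {u} {v} = mk⇔ to from
      where
      to : T (reach G (suc n) u v) → δ u v ≤ suc n
      to t with Equivalence.to T-∨ t
      ... | inj₁ reached = m≤n⇒m≤1+n (Equivalence.to (reach⇔δ≤ n) reached)
      ... | inj₂ via with Any.satisfied (any⁻ _ verts via)
      ...   | w , tw with Equivalence.to T-∧ tw
      ...     | reached , w~v = ≤-trans (δ-adj u w v w~v) (s≤s (Equivalence.to (reach⇔δ≤ n) reached))
      from : δ u v ≤ suc n → T (reach G (suc n) u v)
      from δ≤ with m≤n⇒m<n∨m≡n δ≤
      ... | inj₁ δ<  = Equivalence.from T-∨ (inj₁ (Equivalence.from (reach⇔δ≤ n) (s≤s⁻¹ δ<)))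
      ... | inj₂ δ≡ with δ-step u v δ≡
      ...   | w , δuw≡n , w~v = Equivalence.from T-∨ (inj₂ (any⁺ _ (lose (complete w)
                (Equivalence.from T-∧ (Equivalence.from (reach⇔δ≤ n) (≤-reflexive δuw≡n) , w~v)))))

    dist≡δ : ∀ {u v} → δ u v ≤ length verts → dist G u v ≡ δ u v
    dist≡δ {u} {v} bound = search≡threshold (δ u v) (λ n → reach⇔δ≤ n) (length verts) 0 z≤n bound

IsWeakResolving-mono : ∀ {G k k′ S} → k ≤ k′ → IsWeakResolving G k′ S → IsWeakResolving G k S
IsWeakResolving-mono k≤k′ (unique , resolves) = unique , λ x y x≢y → ≤-trans k≤k′ (resolves x y x≢y)

manhattan : ∀ {q r} → Fin q × Fin r → Fin q × Fin r → ℕ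
manhattan (i , j) (i′ , j′) = ∣ toℕ i - toℕ i′ ∣ + ∣ toℕ j - toℕ j′ ∣

manhattan≡0⇔≡ : ∀ {q r} (u v : Fin q × Fin r) → manhattan u v ≡ 0 ⇔ u ≡ v
manhattan≡0⇔≡ (i , j) (i′ , j′) = mk⇔ to from
  where
  to : manhattan (i , j) (i′ , j′) ≡ 0 → (i , j) ≡ (i′ , j′)
  to eq = cong₂ _,_ (Fin.toℕ-injective (∣m-n∣≡0⇒m≡n (m+n≡0⇒m≡0 _ eq)))
                    (Fin.toℕ-injective (∣m-n∣≡0⇒m≡n (m+n≡0⇒n≡0 _ eq)))
  from : (i , j) ≡ (i′ , j′) → manhattan (i , j) (i′ , j′) ≡ 0
  from refl = cong₂ _+_ (∣n-n∣≡0 (toℕ i)) (∣n-n∣≡0 (toℕ j))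

manhattan-triangle : ∀ {q r} (u w v : Fin q × Fin r) → manhattan u v ≤ manhattan u w + manhattan w v
manhattan-triangle (i , j) (i″ , j″) (i′ , j′) = begin
  ∣ toℕ i - toℕ i′ ∣ + ∣ toℕ j - toℕ j′ ∣
    ≤⟨ +-mono-≤ (∣-∣-triangle (toℕ i) (toℕ i″) (toℕ i′)) (∣-∣-triangle (toℕ j) (toℕ j″) (toℕ j′)) ⟩
  (∣ toℕ i - toℕ i″ ∣ + ∣ toℕ i″ - toℕ i′ ∣) + (∣ toℕ j - toℕ j″ ∣ + ∣ toℕ j″ - toℕ j′ ∣)
    ≡⟨ interchange ∣ toℕ i - toℕ i″ ∣ ∣ toℕ i″ - toℕ i′ ∣ ∣ toℕ j - toℕ j″ ∣ ∣ toℕ j″ - toℕ j′ ∣ ⟩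
  (∣ toℕ i - toℕ i″ ∣ + ∣ toℕ j - toℕ j″ ∣) + (∣ toℕ i″ - toℕ i′ ∣ + ∣ toℕ j″ - toℕ j′ ∣) ∎
  where open ≤-Reasoning

adj⇔manhattan≡1 : ∀ {q r} {u v : Fin q × Fin r} → T (FinGraph.adj (Grid q r) u v) ⇔ manhattan u v ≡ 1
adj⇔manhattan≡1 {u = i , j} {i′ , j′} = mk⇔ to from
  where
  to : T (FinGraph.adj (Grid _ _) (i , j) (i′ , j′)) → manhattan (i , j) (i′ , j′) ≡ 1
  to t with Equivalence.to T-∨ t
  ... | inj₁ t′ with Equivalence.to T-∧ t′
  ...   | i≡i′ , j~j′ =
    cong₂ _+_ (m≡n⇒∣m-n∣≡0 (≡ᵇ⇒≡ (toℕ i) (toℕ i′) i≡i′)) (≡ᵇ⇒≡ ∣ toℕ j - toℕ j′ ∣ 1 j~j′)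
  to t | inj₂ t′ with Equivalence.to T-∧ t′
  ...   | j≡j′ , i~i′ =
    cong₂ _+_ (≡ᵇ⇒≡ ∣ toℕ i - toℕ i′ ∣ 1 i~i′) (m≡n⇒∣m-n∣≡0 (≡ᵇ⇒≡ (toℕ j) (toℕ j′) j≡j′))
  from : manhattan (i , j) (i′ , j′) ≡ 1 → T (FinGraph.adj (Grid _ _) (i , j) (i′ , j′))
  from e with ∣ toℕ i - toℕ i′ ∣ in di
  ... | zero = Equivalence.from T-∨ (inj₁ (Equivalence.from T-∧
                 (≡⇒≡ᵇ (toℕ i) (toℕ i′) (∣m-n∣≡0⇒m≡n di) , ≡⇒≡ᵇ ∣ toℕ j - toℕ j′ ∣ 1 e)))
  ... | suc zero = Equivalence.from T-∨ (inj₂ (Equivalence.from T-∧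
                 (≡⇒≡ᵇ (toℕ j) (toℕ j′) (∣m-n∣≡0⇒m≡n (suc-injective e)) , tt)))

step-towards : ∀ {m k} (x y : Fin m) → ∣ toℕ x - toℕ y ∣ ≡ suc k →
           Σ[ z ∈ Fin m ] ∣ toℕ x - toℕ z ∣ ≡ k × ∣ toℕ z - toℕ y ∣ ≡ 1
step-towards fzero (fsuc y) refl =
  inject₁ y , Fin.toℕ-inject₁ y , trans (cong (∣_- suc (toℕ y) ∣) (Fin.toℕ-inject₁ y)) (∣m-n+m∣≡n (toℕ y) 1)
step-towards {suc (suc _)} (fsuc x) fzero refl = fsuc fzero , ∣-∣-identityʳ (toℕ x) , refl
step-towards {suc zero} (fsuc ()) fzero _
step-towards (fsuc x) (fsuc y) e with step-towards x y e
... | z , xz , zy = fsuc z , xz , zy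

manhattan-step : ∀ {q r n} (u v : Fin q × Fin r) → manhattan u v ≡ suc n →
                 ∃[ w ] manhattan u w ≡ n × manhattan w v ≡ 1
manhattan-step (i , j) (i′ , j′) e with ∣ toℕ i - toℕ i′ ∣ in di
... | suc k with step-towards i i′ di
...   | z , iz , zi′ = (z , j′) , trans (cong (_+ _) iz) (suc-injective e) , cong₂ _+_ zi′ (∣n-n∣≡0 (toℕ j′))
manhattan-step (i , j) (i′ , j′) e | zero with step-towards j j′ e
...   | z , jz , zj′ = (i′ , z) , cong₂ _+_ di jz , cong₂ _+_ (∣n-n∣≡0 (toℕ i′)) zj′

∣toℕ-toℕ∣≤ : ∀ {m} (x y : Fin (suc m)) → ∣ toℕ x - toℕ y ∣ ≤ m
∣toℕ-toℕ∣≤ x y = s≤s⁻¹ (≤-<-trans (∣m-n∣≤m⊔n (toℕ x) (toℕ y)) (⊔-pres-<m (Fin.toℕ<n x) (Fin.toℕ<n y)))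

length-cartesianProduct : ∀ {A B : Set} (xs : List A) (ys : List B) →
                          length (cartesianProduct xs ys) ≡ length xs * length ys
length-cartesianProduct []       ys = refl
length-cartesianProduct (x ∷ xs) ys =
  trans (length-++ (map (x ,_) ys)) (cong₂ _+_ (length-map (x ,_) ys) (length-cartesianProduct xs ys))

dist≡manhattan : ∀ {m n} (u v : Fin (suc m) × Fin (suc n)) → dist (Grid (suc m) (suc n)) u v ≡ manhattan u v
dist≡manhattan {m} {n} u@(i , j) v@(i′ , j′) =
  dist≡δ (Grid _ _) manhattan manhattan≡0⇔≡ adj⇒ step complete bounded
  where
  adj⇒ : ∀ u w v → T (FinGraph.adj (Grid _ _) w v) → manhattan u v ≤ suc (manhattan u w)
  adj⇒ u w v w~v = begin
    manhattan u v                 ≤⟨ manhattan-triangle u w v ⟩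
    manhattan u w + manhattan w v ≡⟨ cong (manhattan u w +_) (Equivalence.to (adj⇔manhattan≡1 {u = w} {v}) w~v) ⟩
    manhattan u w + 1             ≡⟨ +-comm _ 1 ⟩
    suc (manhattan u w)           ∎
    where open ≤-Reasoning
  step : ∀ u v {k} → manhattan u v ≡ suc k → ∃[ w ] manhattan u w ≡ k × T (FinGraph.adj (Grid _ _) w v)
  step u v e with manhattan-step u v e
  ... | w , uw , wv = w , uw , Equivalence.from (adj⇔manhattan≡1 {u = w} {v}) wv
  complete : ∀ w → w ∈ FinGraph.verts (Grid (suc m) (suc n))
  complete (a , b) = ∈-cartesianProduct⁺ (∈-allFin a) (∈-allFin b)
  bounded : manhattan u v ≤ length (FinGraph.verts (Grid (suc m) (suc n)))
  bounded = begin
    manhattan u v                  ≤⟨ +-mono-≤ (∣toℕ-toℕ∣≤ i i′) (∣toℕ-toℕ∣≤ j j′) ⟩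
    m + n                          ≤⟨ +-mono-≤ (m≤m*n m (suc n)) (n≤1+n n) ⟩
    m * suc n + suc n              ≡⟨ +-comm (m * suc n) (suc n) ⟩
    suc m * suc n                  ≡⟨ cong₂ _*_ (length-tabulate {n = suc m} id) (length-tabulate {n = suc n} id) ⟨
    length (allFin (suc m)) * length (allFin (suc n))  ≡⟨ length-cartesianProduct (allFin (suc m)) (allFin (suc n)) ⟨
    length (FinGraph.verts (Grid (suc m) (suc n))) ∎
    where open ≤-Reasoning

module _ (q′ r′ : ℕ) where
  private
    G : FinGraph
    G = Grid (2 + q′) (2 + r′)

  Vertex : Set
  Vertex = Fin (2 + q′) × Fin (2 + r′)

  Δ : Vertex → Vertex → Vertex → ℕ
  Δ x y s = ∣ dist G x s - dist G y s ∣

  -- Landmarks: the two ends of a column b, or of an interior row 1 + a.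
  PairIndex : Set
  PairIndex = Fin (2 + r′) ⊎ Fin q′

  interior : Fin q′ → Fin (2 + q′)
  interior a = fsuc (inject₁ a)

  interior-injective : ∀ {a a′} → interior a ≡ interior a′ → a ≡ a′
  interior-injective = Fin.inject₁-injective ∘ Fin.suc-injective

  interior≢last : ∀ {a} → interior a ≢ fromℕ (suc q′)
  interior≢last = Fin.fromℕ≢inject₁ ∘ sym ∘ Fin.suc-injective

  end₀ end₁ : PairIndex → Vertex
  end₀ (inj₁ b) = fzero , b
  end₀ (inj₂ a) = interior a , fzero
  end₁ (inj₁ b) = fromℕ (suc q′) , b
  end₁ (inj₂ a) = interior a , fromℕ (suc r′)

  end₀-injective : ∀ {d d′} → end₀ d ≡ end₀ d′ → d ≡ d′
  end₀-injective {inj₁ _} {inj₁ _}  refl = refl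
  end₀-injective {inj₂ _} {inj₂ _}  e    = cong inj₂ (interior-injective (cong proj₁ e))

  end₁-injective : ∀ {d d′} → end₁ d ≡ end₁ d′ → d ≡ d′
  end₁-injective {inj₁ _} {inj₁ _} refl = refl
  end₁-injective {inj₁ _} {inj₂ _} e    = ⊥-elim (interior≢last (sym (cong proj₁ e)))
  end₁-injective {inj₂ _} {inj₁ _} e    = ⊥-elim (interior≢last (cong proj₁ e))
  end₁-injective {inj₂ _} {inj₂ _} e    = cong inj₂ (interior-injective (cong proj₁ e))

  end₀≢end₁ : ∀ d d′ → end₀ d ≢ end₁ d′
  end₀≢end₁ (inj₁ _) (inj₁ _) ()
  end₀≢end₁ (inj₁ _) (inj₂ _) ()
  end₀≢end₁ (inj₂ _) (inj₁ _) e = interior≢last (cong proj₁ e)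
  end₀≢end₁ (inj₂ _) (inj₂ _) ()

  column₀ : PairIndex
  column₀ = inj₁ fzero

  pairIndices : List PairIndex
  pairIndices = map inj₁ (allFin (2 + r′)) ++ map inj₂ (allFin q′)

  pairIndices-unique : Unique pairIndices
  pairIndices-unique = ++⁺ (map⁺ inj₁-injective (allFin⁺ _)) (map⁺ inj₂-injective (allFin⁺ _)) disjoint
    where
    disjoint : Disjoint (map inj₁ (allFin (2 + r′))) (map inj₂ (allFin q′))
    disjoint (d∈₁ , d∈₂) with ∈-map⁻ inj₁ d∈₁ | ∈-map⁻ inj₂ d∈₂
    ... | _ , _ , refl | _ , _ , ()

  length-take-pairIndices : ∀ {h} → h ≤ 2 + r′ + q′ → length (take h pairIndices) ≡ h
  length-take-pairIndices {h} h≤ = begin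
    length (take h pairIndices)  ≡⟨ length-take h pairIndices ⟩
    h ⊓ length pairIndices       ≡⟨ cong (h ⊓_) length-pairIndices ⟩
    h ⊓ (2 + r′ + q′)            ≡⟨ m≤n⇒m⊓n≡m h≤ ⟩
    h                            ∎
    where
    open ≡-Reasoning
    length-pairIndices : length pairIndices ≡ 2 + r′ + q′
    length-pairIndices = trans (length-++ (map inj₁ (allFin (2 + r′))))
      (cong₂ _+_ (trans (length-map inj₁ (allFin (2 + r′))) (length-tabulate {n = 2 + r′} id))
                 (trans (length-map inj₂ (allFin q′)) (length-tabulate {n = q′} id)))

  landmarks : ℕ → List Vertex
  landmarks h = map end₀ (take h pairIndices) ++ map end₁ (take h pairIndices)

  landmarks-unique : ∀ h → Unique (landmarks h)
  landmarks-unique h = ++⁺ (map⁺ end₀-injective pairs-unique) (map⁺ end₁-injective pairs-unique) disjoint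
    where
    pairs-unique : Unique (take h pairIndices)
    pairs-unique = take⁺ h pairIndices-unique
    disjoint : Disjoint (map end₀ (take h pairIndices)) (map end₁ (take h pairIndices))
    disjoint (s∈₀ , s∈₁) with ∈-map⁻ end₀ s∈₀ | ∈-map⁻ end₁ s∈₁
    ... | d , _ , refl | d′ , _ , e = end₀≢end₁ d d′ e

  length-landmarks : ∀ {h} → h ≤ 2 + r′ + q′ → length (landmarks h) ≡ 2 * h
  length-landmarks {h} h≤ = begin
    length (landmarks h)                                             ≡⟨ length-++ (map end₀ (take h pairIndices)) ⟩
    length (map end₀ (take h pairIndices)) + length (map end₁ (take h pairIndices))
      ≡⟨ cong₂ _+_ (length-map end₀ (take h pairIndices)) (length-map end₁ (take h pairIndices)) ⟩
    length (take h pairIndices) + length (take h pairIndices)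
      ≡⟨ cong₂ _+_ (length-take-pairIndices h≤) (length-take-pairIndices h≤) ⟩
    h + h                                                            ≡⟨ cong (h +_) (+-identityʳ h) ⟨
    2 * h                                                            ∎
    where open ≡-Reasoning

  along offset : PairIndex → Vertex → ℕ
  along  (inj₁ _) (i , _) = toℕ i
  along  (inj₂ _) (_ , j) = toℕ j
  offset (inj₁ b) (_ , j) = ∣ toℕ j - toℕ b ∣
  offset (inj₂ a) (i , _) = ∣ toℕ i - toℕ (interior a) ∣

  span : PairIndex → ℕ
  span (inj₁ _) = suc q′
  span (inj₂ _) = suc r′

  along≤span : ∀ d x → along d x ≤ span d
  along≤span (inj₁ _) (i , _) = s≤s⁻¹ (Fin.toℕ<n i)
  along≤span (inj₂ _) (_ , j) = s≤s⁻¹ (Fin.toℕ<n j)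

  dist-end₀ : ∀ d x → dist G x (end₀ d) ≡ along d x + offset d x
  dist-end₀ (inj₁ b) x@(i , j) = trans (dist≡manhattan x (end₀ (inj₁ b))) (cong (_+ _) (∣-∣-identityʳ (toℕ i)))
  dist-end₀ (inj₂ a) x@(i , j) = trans (dist≡manhattan x (end₀ (inj₂ a)))
                                       (trans (cong (_ +_) (∣-∣-identityʳ (toℕ j))) (+-comm _ (toℕ j)))

  dist-end₁ : ∀ d x → dist G x (end₁ d) ≡ ∣ along d x - span d ∣ + offset d x
  dist-end₁ (inj₁ b) x@(i , j) = trans (dist≡manhattan x (end₁ (inj₁ b)))
                                       (cong (λ t → ∣ toℕ i - t ∣ + ∣ toℕ j - toℕ b ∣) (Fin.toℕ-fromℕ (suc q′)))
  dist-end₁ (inj₂ a) x@(i , j) = begin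
    dist G x (end₁ (inj₂ a))                                ≡⟨ dist≡manhattan x (end₁ (inj₂ a)) ⟩
    ∣ toℕ i - toℕ (interior a) ∣ + ∣ toℕ j - toℕ (fromℕ (suc r′)) ∣
      ≡⟨ cong (λ t → ∣ toℕ i - toℕ (interior a) ∣ + ∣ toℕ j - t ∣) (Fin.toℕ-fromℕ (suc r′)) ⟩
    ∣ toℕ i - toℕ (interior a) ∣ + ∣ toℕ j - suc r′ ∣       ≡⟨ +-comm ∣ toℕ i - toℕ (interior a) ∣ ∣ toℕ j - suc r′ ∣ ⟩
    ∣ toℕ j - suc r′ ∣ + ∣ toℕ i - toℕ (interior a) ∣       ∎
    where open ≡-Reasoning

  pairΔ : Vertex → Vertex → PairIndex → ℕ
  pairΔ x y d = Δ x y (end₀ d) + Δ x y (end₁ d)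

  pairΔ-bound : ∀ x y d → 2 * ∣ along d x - along d y ∣ ≤ pairΔ x y d × 2 * ∣ offset d x - offset d y ∣ ≤ pairΔ x y d
  pairΔ-bound x y d =
    subst (λ t → 2 * ∣ along d x - along d y ∣ ≤ t × 2 * ∣ offset d x - offset d y ∣ ≤ t) (sym pairΔ≡)
      (ends-bound (along d x) ∣ along d x - span d ∣ (offset d x)
                  (along d y) ∣ along d y - span d ∣ (offset d y) (trans (spans x) (sym (spans y))))
    where
    spans : ∀ v → along d v + ∣ along d v - span d ∣ ≡ span d
    spans v = m≤n⇒m+∣m-n∣≡n (along≤span d v)
    pairΔ≡ : pairΔ x y d ≡ ∣ along d x + offset d x - along d y + offset d y ∣
                         + ∣ ∣ along d x - span d ∣ + offset d x - ∣ along d y - span d ∣ + offset d y ∣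
    pairΔ≡ = cong₂ _+_ (cong₂ ∣_-_∣ (dist-end₀ d x) (dist-end₀ d y)) (cong₂ ∣_-_∣ (dist-end₁ d x) (dist-end₁ d y))

  module _ {x y : Vertex} (x≢y : x ≢ y) where

    coordinates≢ : toℕ (proj₁ x) ≡ toℕ (proj₁ y) → toℕ (proj₂ x) ≢ toℕ (proj₂ y)
    coordinates≢ rows cols = x≢y (cong₂ _,_ (Fin.toℕ-injective rows) (Fin.toℕ-injective cols))

    light⇒coincide : ∀ d → pairΔ x y d < 2 → along d x ≡ along d y × offset d x ≡ offset d y
    light⇒coincide d light = small (proj₁ (pairΔ-bound x y d)) , small (proj₂ (pairΔ-bound x y d))
      where
      small : ∀ {m n} → 2 * ∣ m - n ∣ ≤ pairΔ x y d → m ≡ n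
      small {m} {n} bound = ∣m-n∣≡0⇒m≡n (n<1⇒n≡0 (*-cancelˡ-< 2 ∣ m - n ∣ 1 (≤-<-trans bound light)))

    light-unique : ∀ {d d′} → pairΔ x y d < 2 → pairΔ x y d′ < 2 → d ≡ d′
    light-unique {inj₁ b} {inj₁ b′} light light′ =
      let rows , eb = light⇒coincide (inj₁ b) light; _ , eb′ = light⇒coincide (inj₁ b′) light′ in
      cong inj₁ (Fin.toℕ-injective (equidistant-unique (coordinates≢ rows) eb eb′))
    light-unique {inj₁ b} {inj₂ a} light light′ =
      ⊥-elim (coordinates≢ (proj₁ (light⇒coincide (inj₁ b) light)) (proj₁ (light⇒coincide (inj₂ a) light′)))
    light-unique {inj₂ a} {inj₁ b} light light′ =
      ⊥-elim (coordinates≢ (proj₁ (light⇒coincide (inj₁ b) light′)) (proj₁ (light⇒coincide (inj₂ a) light)))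
    light-unique {inj₂ a} {inj₂ a′} light light′ =
      let cols , ea = light⇒coincide (inj₂ a) light; _ , ea′ = light⇒coincide (inj₂ a′) light′ in
      cong inj₂ (interior-injective (Fin.toℕ-injective (equidistant-unique (λ rows → coordinates≢ rows cols) ea ea′)))

    column₀-bound : 2 * ∣ toℕ (proj₁ x) - toℕ (proj₁ y) ∣ ≤ pairΔ x y column₀
                  × 2 * ∣ toℕ (proj₂ x) - toℕ (proj₂ y) ∣ ≤ pairΔ x y column₀
    column₀-bound = Product.map₂ (subst (λ t → 2 * t ≤ pairΔ x y column₀) offsets≡) (pairΔ-bound x y column₀)
      where
      offsets≡ : ∣ offset column₀ x - offset column₀ y ∣ ≡ ∣ toℕ (proj₂ x) - toℕ (proj₂ y) ∣
      offsets≡ = cong₂ ∣_-_∣ (∣-∣-identityʳ (toℕ (proj₂ x))) (∣-∣-identityʳ (toℕ (proj₂ y)))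

    2≤pairΔ-column₀ : 2 ≤ pairΔ x y column₀
    2≤pairΔ-column₀ = ≮⇒≥ λ light → let rows , cols = light⇒coincide column₀ light in
      coordinates≢ rows (trans (sym (∣-∣-identityʳ (toℕ (proj₂ x)))) (trans cols (∣-∣-identityʳ (toℕ (proj₂ y)))))

    light⇒4≤pairΔ-column₀ : ∀ {d} → pairΔ x y d < 2 → 4 ≤ pairΔ x y column₀
    light⇒4≤pairΔ-column₀ {inj₁ b} light =
      let rows , eb = light⇒coincide (inj₁ b) light in
      ≤-trans (*-monoʳ-≤ 2 (equidistant⇒2≤∣m-n∣ (coordinates≢ rows) eb)) (proj₂ column₀-bound)
    light⇒4≤pairΔ-column₀ {inj₂ a} light =
      let cols , ea = light⇒coincide (inj₂ a) light in
      ≤-trans (*-monoʳ-≤ 2 (equidistant⇒2≤∣m-n∣ (λ rows → coordinates≢ rows cols) ea)) (proj₁ column₀-bound)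

    landmarks-resolve : ∀ h → suc h ≤ 2 + r′ + q′ → 2 * suc h ≤ ΔS G (landmarks (suc h)) x y
    landmarks-resolve h h≤ = begin
      2 * suc h                                        ≡⟨ cong (2 *_) (length-take-pairIndices h≤) ⟨
      2 * length (take (suc h) pairIndices)            ≤⟨ 2*length≤sum-one-light (pairΔ x y) {column₀} _ 2≤pairΔ-column₀
                                                            light⇒4≤pairΔ-column₀ light-unique
                                                            (AllPairs.tail (take⁺ (suc h) pairIndices-unique)) ⟩
      sum (map (pairΔ x y) (take (suc h) pairIndices)) ≡⟨ sum-map-pairs (Δ x y) end₀ end₁ (take (suc h) pairIndices) ⟨
      ΔS G (landmarks (suc h)) x y                     ∎
      where open ≤-Reasoning

  weak-resolving-landmarks : ∀ h → suc h ≤ 2 + r′ + q′ → IsWeakResolving G (2 * suc h) (landmarks (suc h))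
  weak-resolving-landmarks h h≤ = landmarks-unique (suc h) , λ _ _ x≢y → landmarks-resolve x≢y h h≤

  private
    v₀₀ v₀₁ v₁₀ v₁₁ : Vertex
    v₀₀ = fzero , fzero
    v₀₁ = fzero , fsuc fzero
    v₁₀ = fsuc fzero , fzero
    v₁₁ = fsuc fzero , fsuc fzero

  Δ-v₀₀-v₁₀≡1 : ∀ s → Δ v₀₀ v₁₀ s ≡ 1
  Δ-v₀₀-v₁₀≡1 s@(i , j) =
    trans (cong₂ ∣_-_∣ (dist≡manhattan v₀₀ s) (dist≡manhattan v₁₀ s)) (unit-gap (toℕ i) (toℕ j))
    where
    unit-gap : ∀ a b → ∣ a + b - ∣ 1 - a ∣ + b ∣ ≡ 1
    unit-gap zero    b = ∣m-n+m∣≡n b 1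
    unit-gap (suc a) b = trans (∣-∣-comm (suc (a + b)) (a + b)) (∣m-n+m∣≡n (a + b) 1)

  length-lower-bound : ∀ {k S} → IsWeakResolving G k S → k ≤ length S
  length-lower-bound {k} {S} (_ , resolves) = begin
    k                 ≤⟨ resolves v₀₀ v₁₀ (λ ()) ⟩
    ΔS G S v₀₀ v₁₀    ≡⟨ sum-map-≡1 Δ-v₀₀-v₁₀≡1 S ⟩
    length S          ∎
    where open ≤-Reasoning

  square-Δ : ∀ s → (Δ v₀₀ v₁₁ s ≡ 0 × Δ v₀₁ v₁₀ s ≡ 2) ⊎ (Δ v₀₀ v₁₁ s ≡ 2 × Δ v₀₁ v₁₀ s ≡ 0)
  square-Δ s@(i , j) = subst₂ (λ m n → (m ≡ 0 × n ≡ 2) ⊎ (m ≡ 2 × n ≡ 0))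
    (sym (cong₂ ∣_-_∣ (dist≡manhattan v₀₀ s) (dist≡manhattan v₁₁ s)))
    (sym (cong₂ ∣_-_∣ (dist≡manhattan v₀₁ s) (dist≡manhattan v₁₀ s)))
    (gaps (toℕ i) (toℕ j))
    where
    gaps : ∀ a b → (∣ a + b - ∣ 1 - a ∣ + ∣ 1 - b ∣ ∣ ≡ 0 × ∣ a + ∣ 1 - b ∣ - ∣ 1 - a ∣ + b ∣ ≡ 2)
                 ⊎ (∣ a + b - ∣ 1 - a ∣ + ∣ 1 - b ∣ ∣ ≡ 2 × ∣ a + ∣ 1 - b ∣ - ∣ 1 - a ∣ + b ∣ ≡ 0)
    gaps zero    zero    = inj₂ (refl , refl)
    gaps zero    (suc b) = inj₁ (∣n-n∣≡0 b , ∣m-n+m∣≡n b 2)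
    gaps (suc a) zero    = inj₁ (m≡n⇒∣m-n∣≡0 (trans (cong suc (+-identityʳ a)) (+-comm 1 a)) ,
                                 trans (cong₂ ∣_-_∣ (cong suc (+-comm a 1)) (+-identityʳ a))
                                       (trans (∣-∣-comm (2 + a) a) (∣m-n+m∣≡n a 2)))
    gaps (suc a) (suc b) = inj₂ (trans (cong (λ t → ∣ suc t - a + b ∣) (+-suc a b))
                                       (trans (∣-∣-comm (2 + (a + b)) (a + b)) (∣m-n+m∣≡n (a + b) 2)) ,
                                 m≡n⇒∣m-n∣≡0 (sym (+-suc a b)))

  square-ΔS-sum : ∀ S → ΔS G S v₀₀ v₁₁ + ΔS G S v₀₁ v₁₀ ≡ 2 * length S
  square-ΔS-sum []      = refl
  square-ΔS-sum (s ∷ S) = begin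
    (Δ v₀₀ v₁₁ s + ΔS G S v₀₀ v₁₁) + (Δ v₀₁ v₁₀ s + ΔS G S v₀₁ v₁₀)
      ≡⟨ interchange (Δ v₀₀ v₁₁ s) (ΔS G S v₀₀ v₁₁) (Δ v₀₁ v₁₀ s) (ΔS G S v₀₁ v₁₀) ⟩
    (Δ v₀₀ v₁₁ s + Δ v₀₁ v₁₀ s) + (ΔS G S v₀₀ v₁₁ + ΔS G S v₀₁ v₁₀)
      ≡⟨ cong₂ _+_ (Sum.[ uncurry (cong₂ _+_) , uncurry (cong₂ _+_) ]′ (square-Δ s)) (square-ΔS-sum S) ⟩
    2 + 2 * length S
      ≡⟨ *-suc 2 (length S) ⟨
    2 * suc (length S) ∎
    where open ≡-Reasoning

  square-ΔS-even : ∀ S → 2 ∣ ΔS G S v₀₀ v₁₁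
  square-ΔS-even []      = divides 0 refl
  square-ΔS-even (s ∷ S) = ∣m∣n⇒∣m+n (Sum.[ (λ (e , _) → subst (2 ∣_) (sym e) (divides 0 refl)) ,
                                            (λ (e , _) → subst (2 ∣_) (sym e) (divides 1 refl)) ]′ (square-Δ s))
                                     (square-ΔS-even S)

  odd-length-lower-bound : ∀ {k S} → k % 2 ≡ 1 → IsWeakResolving G k S → suc k ≤ length S
  odd-length-lower-bound {k} {S} k-odd w@(_ , resolves) = ≤∧≢⇒< (length-lower-bound w) k≢length
    where
    k≢length : k ≢ length S
    k≢length k≡length = 0≢1+n (trans (sym (n∣m⇒m%n≡0 k 2 2∣k)) k-odd)
      where
      open ≤-Reasoning
      ΔS≤k : ΔS G S v₀₀ v₁₁ ≤ k
      ΔS≤k = +-cancelʳ-≤ k _ k (begin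
        ΔS G S v₀₀ v₁₁ + k                 ≤⟨ +-monoʳ-≤ (ΔS G S v₀₀ v₁₁) (resolves v₀₁ v₁₀ (λ ())) ⟩
        ΔS G S v₀₀ v₁₁ + ΔS G S v₀₁ v₁₀    ≡⟨ square-ΔS-sum S ⟩
        2 * length S                       ≡⟨ cong (2 *_) k≡length ⟨
        2 * k                              ≡⟨ cong (k +_) (+-identityʳ k) ⟩
        k + k                              ∎)
      2∣k : 2 ∣ k
      2∣k = subst (2 ∣_) (≤-antisym ΔS≤k (resolves v₀₀ v₁₁ (λ ()))) (square-ΔS-even S)

  wdim-even : ∀ {k} → 2 ∣ k → 1 ≤ k → k ≤ 2 * (2 + r′ + q′) → IsWdim G k k
  wdim-even (divides zero    refl) ()
  wdim-even (divides (suc h) refl) _ k≤ = subst (λ n → IsWdim G n n) (*-comm 2 (suc h))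
    ((landmarks (suc h) , weak-resolving-landmarks h h≤ , length-landmarks h≤) , λ _ → length-lower-bound)
    where
    h≤ : suc h ≤ 2 + r′ + q′
    h≤ = *-cancelˡ-≤ 2 (subst (_≤ 2 * (2 + r′ + q′)) (*-comm (suc h) 2) k≤)

  wdim-odd : ∀ {k} → k % 2 ≡ 1 → k ≤ 2 * (2 + r′ + q′) → IsWdim G k (k + 1)
  wdim-odd {k} k-odd k≤ =
    (landmarks (suc h) , IsWeakResolving-mono {G} k≤2+2h (weak-resolving-landmarks h h≤) ,
                         trans (length-landmarks h≤) (sym k+1≡2+2h)) ,
    λ S w → subst (_≤ length S) (+-comm 1 k) (odd-length-lower-bound k-odd w)
    where
    h : ℕ
    h = k / 2
    k≡1+2h : k ≡ 1 + 2 * h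
    k≡1+2h = trans (m≡m%n+[m/n]*n k 2) (cong₂ _+_ k-odd (*-comm h 2))
    h≤ : suc h ≤ 2 + r′ + q′
    h≤ = *-cancelˡ-< 2 h (2 + r′ + q′) (subst (_≤ 2 * (2 + r′ + q′)) k≡1+2h k≤)
    k+1≡2+2h : k + 1 ≡ 2 * suc h
    k+1≡2+2h = trans (+-comm k 1) (trans (cong suc k≡1+2h) (sym (*-suc 2 h)))
    k≤2+2h : k ≤ 2 * suc h
    k≤2+2h = ≤-trans (n≤1+n k) (≤-reflexive (trans (+-comm 1 k) k+1≡2+2h))

theorem4p2 : (q r : ℕ) → 2 ≤ q → 2 ≤ r →
    (k : ℕ) → 1 ≤ k → k ≤ 2 * q + 2 * r ∸ 4 →
    ((k % 2 ≡ 0) → IsWdim (Grid q r) k k)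
    × ((k % 2 ≡ 1) → IsWdim (Grid q r) k (k + 1))
theorem4p2 (suc (suc q′)) (suc (suc r′)) (s≤s (s≤s z≤n)) (s≤s (s≤s z≤n)) k 1≤k k≤ =
  (λ k-even → wdim-even q′ r′ (m%n≡0⇒n∣m k 2 k-even) 1≤k k≤2N) ,
  (λ k-odd → wdim-odd q′ r′ k-odd k≤2N)
  where
  perimeter : 2 * (2 + q′) + 2 * (2 + r′) ∸ 4 ≡ 2 * (2 + r′ + q′)
  perimeter = trans (cong (_∸ 4) (regroup q′ r′)) (m+n∸m≡n 4 (2 * (2 + r′ + q′)))
    where
    regroup : ∀ a b → 2 * (2 + a) + 2 * (2 + b) ≡ 4 + 2 * (2 + b + a)
    regroup = solve-∀
  k≤2N : k ≤ 2 * (2 + r′ + q′)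
  k≤2N = subst (k ≤_) perimeter k≤
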